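{- Let $\mathcal{G}$ be an undirected connected graph without loops on $C=\{1,\dots,L\}$, let $k\ge1$, and let $F^k$ be as in the context. A subspace $A\subseteq\mathbb{B}^{2L}$ is a trap space for $F^k$ if and only if $A=x[I]$ for some fixed point $x$ of $F^k$ and some $I\subseteq\{1,\dots,2L\}$ with $I_N\subseteq I_D$ such that for every $i\in C\setminus I_N$: (i) if $x_i=1$, then the set $\{j\in S(i)\setminus I_D : x_{j+L}=1\}$ has cardinality at least $k$; (ii) if $x_i=0$, then the set $\{j\in S(i)\setminus I_D : x_{j+L}=1\}\cup(S(i)\cap I_D)$ has cardinality smaller than $k$.
   Context: For $i\in C$ let $S(i)$ be the set of neighbours of $i$ in $\mathcal{G}$. $\mathbb{B}=\{0,1\}$. States of $\mathbb{B}^{2L}$ are written $x=(n,d)=(n_1,\dots,n_L,d_1,\dots,d_L)$, so $x_i=n_i$ and $x_{i+L}=d_i$. $F^k\colon\mathbb{B}^{2L}\to\mathbb{B}^{2L}$ is defined by $F^k_i(n,d)=1$ iff $\sum_{j\in S(i)}d_j\ge k$, and $F^k_{i+L}(n,d)=1-n_i$, for $i\in C$. For $I\subseteq\{1,\dots,2L\}$: $I_N=I\cap C$ and $I_D=\{i-L: i\in I, i>L\}$. $AD_{F^k}$ has an edge from $y$ to the state obtained by flipping coordinate $i$ whenever $F^k_i(y)\neq y_i$. The subspace $x[I]$ is $\{y: y_i=x_i\ \forall i\notin I\}$; a trap space is a subspace such that every successor in $AD_{F^k}$ of its states lies in it. A fixed point is $x$ with $F^k(x)=x$. -}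

module Defs where

open import Data.Bool using (Bool; true; false; not; if_then_else_)
open import Data.Nat using (ℕ; _≤ᵇ_; _≤_; _<_)
open import Data.Fin using (Fin; _↑ˡ_; _↑ʳ_; splitAt; _≟_)
open import Data.Fin.Subset using (Subset; _∈_; _∉_; _⊆_; _∩_; _∪_; ∁; ∣_∣)
open import Data.Vec using (tabulate; lookup)
open import Data.Sum using (inj₁; inj₂)
open import Data.Product using (Σ; _×_; ∃)
open import Relation.Nullary using (¬_; does)
open import Relation.Binary.PropositionalEquality using (_≡_; _≢_)
open import Relation.Binary.Construct.Closure.ReflexiveTransitive using (Star)

-- Vertex set C = {1,…,L} is Fin L.  Coordinates {1,…,2L} are Fin (L + L):
-- coordinate i ∈ C is  i ↑ˡ L  (the n-part), coordinate i+L is  L ↑ʳ i  (the d-part).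

record Graph (L : ℕ) : Set where
  field
    adj       : Fin L → Fin L → Bool
    symmetric : ∀ i j → adj i j ≡ adj j i
    loopless  : ∀ i → adj i i ≡ false
    connected : ∀ i j → Star (λ a b → adj a b ≡ true) i j

open Graph public

S : ∀ {L} → Graph L → Fin L → Subset L
S G i = tabulate (adj G i)

State : ℕ → Set
State L = Fin (L + L) → Bool
  where open Data.Nat using (_+_)

module _ (L : ℕ) where
  open Data.Nat using (_+_)

  nPart : State L → Fin L → Bool
  nPart x i = x (i ↑ˡ L)

  dPart : State L → Fin L → Bool
  dPart x i = x (L ↑ʳ i)

  Dset : State L → Subset L
  Dset x = tabulate (dPart x)

  -- Σ_{j ∈ S(i)} d_j  (over 𝔹 this is the number of neighbours j with d_j = 1)
  neighSum : Graph L → State L → Fin L → ℕ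
  neighSum G x i = ∣ S G i ∩ Dset x ∣

  F : Graph L → ℕ → State L → State L
  F G k x p with splitAt L p
  ... | inj₁ i = k ≤ᵇ neighSum G x i
  ... | inj₂ i = not (nPart x i)

  FixedPoint : Graph L → ℕ → State L → Set
  FixedPoint G k x = ∀ p → F G k x p ≡ x p

  flip : State L → Fin (L + L) → State L
  flip y p q = if does (q ≟ p) then not (y q) else y q

  _∈[_]_ : State L → Subset (L + L) → State L → Set
  y ∈[ I ] x = ∀ p → p ∉ I → y p ≡ x p

  IsTrapSet : Graph L → ℕ → (State L → Set) → Set
  IsTrapSet G k A = ∀ y → A y → ∀ p → F G k y p ≢ y p → A (flip y p)

  Subspace : State L → Subset (L + L) → State L → Set
  Subspace x I y = y ∈[ I ] x

  IsTrapSpace : Graph L → ℕ → State L → Subset (L + L) → Set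
  IsTrapSpace G k x I = IsTrapSet G k (Subspace x I)

  IN : Subset (L + L) → Subset L
  IN I = tabulate (λ i → lookup I (i ↑ˡ L))

  ID : Subset (L + L) → Subset L
  ID I = tabulate (λ i → lookup I (L ↑ʳ i))

  SameSet : (State L → Set) → (State L → Set) → Set
  SameSet A B = ∀ y → (A y → B y) × (B y → A y)

  Conditions : Graph L → ℕ → State L → Subset (L + L) → Set
  Conditions G k x I =
    ∀ i → i ∉ IN I →
      (nPart x i ≡ true →
         k ≤ ∣ (S G i ∩ ∁ (ID I)) ∩ Dset x ∣)
    × (nPart x i ≡ false →
         ∣ ((S G i ∩ ∁ (ID I)) ∩ Dset x) ∪ (S G i ∩ ID I) ∣ < k)

module Submission where

-- A subspace x[I] is a trap space exactly when every frozen coordinate p ∉ I is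
-- steady, F(z)_p = z_p, at every state z of x[I].  Steadiness of a frozen d_i
-- forces n_i to be frozen as well (flipping n_i would flip F at d_i), whence
-- I_N ⊆ I_D.  A frozen n_i is steady throughout x[I] iff the threshold test at i
-- has the same outcome for all values of the free d-coordinates; the neighbour
-- count is extremal at the two states where all of them are cleared, resp. set,
-- which gives conditions (i) and (ii).  It remains to find a fixed point inside a
-- trap space: slaving every free n_i to its partner, n_i = ¬ d_i, turns the free
-- dynamics into a symmetric threshold network d_v := [#active neighbours < k] on
-- the d-coordinates, which stabilises because every corrective flip strictly
-- lowers a Hopfield energy.

open import Defs
open import Data.Nat using (ℕ; _≤_; _+_)
open import Data.Fin.Subset using (Subset; _⊆_)
open import Data.Product using (Σ; _×_)
open import Function.Bundles using (_⇔_)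

open import Data.Bool using (Bool; true; false; not; _∧_; T; if_then_else_)
open import Data.Bool.Properties using (T-≡; ∧-zeroʳ; ∧-identityʳ; not-involutive; not-¬)
  renaming (_≟_ to _≟ᵇ_)
open import Data.Fin using (Fin; zero; suc; _≟_; punchIn; _↑ˡ_; _↑ʳ_; splitAt; join)
open import Data.Fin.Properties using (punchInᵢ≢i; any?; join-splitAt; splitAt-↑ˡ; splitAt-↑ʳ)
open import Data.Fin.Subset using (_∈_; _∉_; _∩_; _∪_; ∁; ∣_∣)
open import Data.Fin.Subset.Properties
  using (_∈?_; x∈p∩q⁺; x∈p∩q⁻; x∈p∪q⁺; x∈p∪q⁻; x∈∁p⇒x∉p; x∉p⇒x∈∁p; p⊆q⇒∣p∣≤∣q∣)
open import Data.Nat using (suc; _<_; _*_; _≤ᵇ_; pred; NonZero; >-nonZero)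
open import Data.Nat.Induction using (<-wellFounded)
open import Data.Nat.Properties
  using (≤ᵇ⇒≤; ≤⇒≤ᵇ; ≰⇒>; <⇒≱; +-cancelʳ-<; +-monoʳ-<; +-mono-≤-<; +-mono-<-≤; +-identityʳ;
         ≤-refl; ≤-reflexive; ≤-trans; <-≤-trans; ≤-<-trans; +-0-commutativeMonoid;
         suc[m]≤n⇒m≤pred[n]; m≤pred[n]⇒suc[m]≤n)
open import Data.Nat.Tactic.RingSolver using (solve-∀)
open import Data.Product using (_,_; proj₁; proj₂)
open import Data.Sum using (inj₁; inj₂; [_,_]′)
open import Data.Vec using (tabulate; lookup)
open import Data.Vec.Functional using (updateAt)
open import Data.Vec.Functional.Properties using (updateAt-updates; updateAt-minimal)
open import Data.Vec.Properties using (lookup∘tabulate; []=⇒lookup; lookup⇒[]=)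
open import Function.Base using (_∘_)
open import Function.Bundles using (mk⇔; Equivalence)
open import Induction.WellFounded using (Acc; acc)
open import Relation.Binary.PropositionalEquality
open import Relation.Nullary using (¬_; Dec; does; yes; no; contradiction; ¬?)
open import Relation.Nullary.Decidable using (_×-dec_; dec-true; dec-false)

open import Algebra.Properties.CommutativeMonoid.Sum +-0-commutativeMonoid
  using (sum; sum-syntax; sum-remove; ∑-distrib-+; sum-cong-≗; sum-replicate-zero)

iverson : Bool → ℕ
iverson true  = 1
iverson false = 0

∣tabulate∩tabulate∣≡∑ : ∀ {n} (f g : Fin n → Bool) → ∣ tabulate f ∩ tabulate g ∣ ≡ ∑[ j < n ] iverson (f j ∧ g j)
∣tabulate∩tabulate∣≡∑ {0} f g = refl
∣tabulate∩tabulate∣≡∑ {suc n} f g with f zero ∧ g zero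
... | true  = cong suc (∣tabulate∩tabulate∣≡∑ (f ∘ suc) (g ∘ suc))
... | false = ∣tabulate∩tabulate∣≡∑ (f ∘ suc) (g ∘ suc)

∑-agreeOff : ∀ {n} (f g : Fin n → ℕ) v → (∀ j → j ≢ v → f j ≡ g j) →
             sum f + g v ≡ sum g + f v
∑-agreeOff {suc n} f g v f≈g = begin
  sum f + g v                            ≡⟨ cong (_+ g v) (sum-remove f) ⟩
  f v + sum (f ∘ punchIn v) + g v        ≡⟨ cong (λ s → f v + s + g v) (sum-cong-≗ rest) ⟩
  f v + sum (g ∘ punchIn v) + g v        ≡⟨ swap (f v) _ (g v) ⟩
  g v + sum (g ∘ punchIn v) + f v        ≡⟨ cong (_+ f v) (sym (sum-remove g)) ⟩
  sum g + f v                            ∎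
  where
  open ≡-Reasoning
  rest : ∀ j → f (punchIn v j) ≡ g (punchIn v j)
  rest j = f≈g (punchIn v j) (punchInᵢ≢i v j)
  swap : ∀ a s b → a + s + b ≡ b + s + a
  swap = solve-∀

m+n≡o+p∧p<n⇒m<o : ∀ {m n o p} → m + n ≡ o + p → p < n → m < o
m+n≡o+p∧p<n⇒m<o {m} {n} {o} eq p<n =
  +-cancelʳ-< n m o (≤-trans (≤-reflexive (cong suc eq)) (+-monoʳ-< o p<n))

≤ᵇ≡true⇒≤ : ∀ {m n} → (m ≤ᵇ n) ≡ true → m ≤ n
≤ᵇ≡true⇒≤ {m} {n} eq = ≤ᵇ⇒≤ m n (Equivalence.from T-≡ eq)

≤ᵇ≡false⇒> : ∀ {m n} → (m ≤ᵇ n) ≡ false → n < m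
≤ᵇ≡false⇒> eq = ≰⇒> (λ m≤n → subst T eq (≤⇒≤ᵇ m≤n))

≤⇒≤ᵇ≡true : ∀ {m n} → m ≤ n → (m ≤ᵇ n) ≡ true
≤⇒≤ᵇ≡true m≤n = Equivalence.to T-≡ (≤⇒≤ᵇ m≤n)

>⇒≤ᵇ≡false : ∀ {m n} → n < m → (m ≤ᵇ n) ≡ false
>⇒≤ᵇ≡false {m} {n} n<m with m ≤ᵇ n in eq
... | true  = contradiction (≤ᵇ≡true⇒≤ eq) (<⇒≱ n<m)
... | false = refl

module ThresholdNetwork {n : ℕ} (adj : Fin n → Fin n → Bool)
  (adj-sym : ∀ i j → adj i j ≡ adj j i) (adj-irrefl : ∀ i → adj i i ≡ false)
  (k : ℕ) .{{_ : NonZero k}} where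

  count : (Fin n → Bool) → Fin n → ℕ
  count d v = ∑[ j < n ] iverson (adj v j ∧ d j)

  Settled : (Fin n → Bool) → Fin n → Set
  Settled d v = d v ≡ not (k ≤ᵇ count d v)

  row : (Fin n → Bool) → Fin n → ℕ
  row d u = ∑[ j < n ] iverson (adj u j ∧ (d u ∧ d j))

  internalEdges : (Fin n → Bool) → ℕ
  internalEdges d = ∑[ u < n ] row d u

  inactive : (Fin n → Bool) → ℕ
  inactive d = ∑[ u < n ] iverson (not (d u))

  weight : ℕ
  weight = pred k + k

  -- Activating an unsettled vertex raises the first term by
  -- 2·count ≤ 2(k − 1), deactivating one lowers it by 2·count ≥ 2k, while the
  -- second term moves by 2k − 1 in the opposite direction.
  energy : (Fin n → Bool) → ℕ
  energy d = internalEdges d + weight * inactive d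

  module Activation (d₀ d₁ : Fin n → Bool) (v : Fin n)
    (d₀v : d₀ v ≡ false) (d₁v : d₁ v ≡ true) (agree : ∀ u → u ≢ v → d₀ u ≡ d₁ u) where

    count-activate : count d₀ v ≡ count d₁ v
    count-activate = sum-cong-≗ same
      where
      same : ∀ j → iverson (adj v j ∧ d₀ j) ≡ iverson (adj v j ∧ d₁ j)
      same j with j ≟ v
      ... | yes refl rewrite adj-irrefl j = refl
      ... | no j≢v   rewrite agree j j≢v = refl

    inactive-activate : inactive d₁ + 1 ≡ inactive d₀
    inactive-activate = begin
      inactive d₁ + 1                       ≡⟨ cong (λ b → inactive d₁ + iverson (not b)) (sym d₀v) ⟩
      inactive d₁ + iverson (not (d₀ v))    ≡⟨ ∑-agreeOff _ _ v (λ u u≢v → cong (iverson ∘ not) (sym (agree u u≢v))) ⟩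
      inactive d₀ + iverson (not (d₁ v))    ≡⟨ cong (λ b → inactive d₀ + iverson (not b)) d₁v ⟩
      inactive d₀ + 0                       ≡⟨ +-identityʳ _ ⟩
      inactive d₀                           ∎
      where open ≡-Reasoning

    row-activate : ∀ u → u ≢ v → row d₁ u ≡ row d₀ u + iverson (adj u v ∧ d₀ u)
    row-activate u u≢v = begin
      row d₁ u                                      ≡⟨ sym (+-identityʳ _) ⟩
      row d₁ u + 0                                  ≡⟨ cong (λ b → row d₁ u + iverson b) (sym off) ⟩
      row d₁ u + iverson (adj u v ∧ (d₀ u ∧ d₀ v))  ≡⟨ ∑-agreeOff _ _ v (λ j j≢v → cong (λ b → iverson (adj u j ∧ b))
                                                         (sym (cong₂ _∧_ (agree u u≢v) (agree j j≢v)))) ⟩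
      row d₀ u + iverson (adj u v ∧ (d₁ u ∧ d₁ v))  ≡⟨ cong (λ b → row d₀ u + iverson (adj u v ∧ b)) on ⟩
      row d₀ u + iverson (adj u v ∧ d₀ u)           ∎
      where
      open ≡-Reasoning
      off : adj u v ∧ (d₀ u ∧ d₀ v) ≡ false
      off rewrite d₀v | ∧-zeroʳ (d₀ u) = ∧-zeroʳ (adj u v)
      on : d₁ u ∧ d₁ v ≡ d₀ u
      on = trans (cong₂ _∧_ (sym (agree u u≢v)) d₁v) (∧-identityʳ (d₀ u))

    row-inactive : row d₀ v ≡ 0
    row-inactive = trans (sum-cong-≗ vanish) (sum-replicate-zero n)
      where
      vanish : ∀ j → iverson (adj v j ∧ (d₀ v ∧ d₀ j)) ≡ 0
      vanish j rewrite d₀v = cong iverson (∧-zeroʳ (adj v j))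

    row-active : row d₁ v ≡ count d₁ v
    row-active = sum-cong-≗ (λ j → cong (λ b → iverson (adj v j ∧ (b ∧ d₁ j))) d₁v)

    internalEdges-activate : internalEdges d₁ ≡ internalEdges d₀ + count d₀ v + count d₀ v
    internalEdges-activate = begin
      internalEdges d₁                                   ≡⟨ sym (+-identityʳ _) ⟩
      internalEdges d₁ + 0                               ≡⟨ cong (internalEdges d₁ +_) (sym gv≡0) ⟩
      internalEdges d₁ + g v                             ≡⟨ ∑-agreeOff (row d₁) g v row-activate ⟩
      sum g + row d₁ v                                   ≡⟨ cong₂ _+_ (∑-distrib-+ (row d₀) _) row-active ⟩
      internalEdges d₀ + ∑[ u < n ] iverson (adj u v ∧ d₀ u) + count d₁ v
                                                         ≡⟨ cong₂ (λ a b → internalEdges d₀ + a + b) column (sym count-activate) ⟩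
      internalEdges d₀ + count d₀ v + count d₀ v         ∎
      where
      open ≡-Reasoning
      g : Fin n → ℕ
      g u = row d₀ u + iverson (adj u v ∧ d₀ u)
      gv≡0 : g v ≡ 0
      gv≡0 rewrite row-inactive | adj-irrefl v = refl
      column : ∑[ u < n ] iverson (adj u v ∧ d₀ u) ≡ count d₀ v
      column = sum-cong-≗ (λ u → cong (λ b → iverson (b ∧ d₀ u)) (adj-sym u v))

    energy-activate : energy d₁ + weight ≡ energy d₀ + (count d₀ v + count d₀ v)
    energy-activate rewrite internalEdges-activate | sym inactive-activate =
      rearrange (internalEdges d₀) (count d₀ v) (inactive d₁) weight
      where
      rearrange : ∀ e c a w → e + c + c + w * a + w ≡ e + w * (a + 1) + (c + c)
      rearrange = solve-∀

  pred[k]<k : pred k < k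
  pred[k]<k = m≤pred[n]⇒suc[m]≤n ≤-refl

  energy-decreases : ∀ d v → ¬ Settled d v → energy (updateAt d v not) < energy d
  energy-decreases d v unsettled with d v in dv | k ≤ᵇ count d v in k≤?c
  ... | true  | false = contradiction refl unsettled
  ... | false | true  = contradiction refl unsettled
  ... | true  | true  =
    m+n≡o+p∧p<n⇒m<o (sym (energy-activate d′ d v d′v≡ dv agree))
      (subst (weight <_) (cong₂ _+_ c≡ c≡) (+-mono-<-≤ (<-≤-trans pred[k]<k k≤c) k≤c))
    where
    open Activation
    d′ : Fin n → Bool
    d′ = updateAt d v not
    d′v≡ : d′ v ≡ false
    d′v≡ = trans (updateAt-updates v d) (cong not dv)
    agree : ∀ u → u ≢ v → d′ u ≡ d u
    agree u u≢v = updateAt-minimal u v d u≢v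
    c≡ : count d v ≡ count d′ v
    c≡ = sym (count-activate d′ d v d′v≡ dv agree)
    k≤c : k ≤ count d v
    k≤c = ≤ᵇ≡true⇒≤ k≤?c
  ... | false | false =
    m+n≡o+p∧p<n⇒m<o (energy-activate d d′ v dv d′v≡ agree)
      (+-mono-≤-< (suc[m]≤n⇒m≤pred[n] c<k) c<k)
    where
    open Activation
    d′ : Fin n → Bool
    d′ = updateAt d v not
    d′v≡ : d′ v ≡ true
    d′v≡ = trans (updateAt-updates v d) (cong not dv)
    agree : ∀ u → u ≢ v → d u ≡ d′ u
    agree u u≢v = sym (updateAt-minimal u v d u≢v)
    c<k : count d v < k
    c<k = ≤ᵇ≡false⇒> k≤?c

  module _ {Free : Fin n → Set} (free? : ∀ v → Dec (Free v)) (d₀ : Fin n → Bool) where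

    Stable : (Fin n → Bool) → Set
    Stable d = ∀ v → Free v → Settled d v

    AgreesOffFree : (Fin n → Bool) → Set
    AgreesOffFree d = ∀ v → ¬ Free v → d v ≡ d₀ v

    descend : ∀ d → Acc _<_ (energy d) → AgreesOffFree d → Σ (Fin n → Bool) λ d′ → Stable d′ × AgreesOffFree d′
    descend d (acc smaller) agrees with any? (λ v → free? v ×-dec ¬? (d v ≟ᵇ not (k ≤ᵇ count d v)))
    ... | yes (v , free , unsettled) =
      descend (updateAt d v not) (smaller (energy-decreases d v unsettled))
        (λ u fixed → trans (updateAt-minimal u v d (λ { refl → fixed free })) (agrees u fixed))
    ... | no allSettled = d , stable , agrees
      where
      stable : Stable d
      stable v free with d v ≟ᵇ not (k ≤ᵇ count d v)
      ... | yes settled  = settled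
      ... | no unsettled = contradiction (v , free , unsettled) allSettled

    settle : Σ (Fin n → Bool) λ d → Stable d × AgreesOffFree d
    settle = descend d₀ (<-wellFounded _) (λ _ _ → refl)

↑ˡ-↑ʳ-elim : ∀ {m n} (Q : Fin (m + n) → Set) →
             (∀ i → Q (i ↑ˡ n)) → (∀ j → Q (m ↑ʳ j)) → ∀ p → Q p
↑ˡ-↑ʳ-elim {m} {n} Q left right p = subst Q (join-splitAt m n p) (by-cases (splitAt m p))
  where
  by-cases : ∀ s → Q (join m n s)
  by-cases (inj₁ i) = left i
  by-cases (inj₂ j) = right j

↑ʳ≢↑ˡ : ∀ {m n} (i : Fin n) (j : Fin m) → m ↑ʳ i ≢ j ↑ˡ n
↑ʳ≢↑ˡ {m} {n} i j eq with trans (sym (splitAt-↑ʳ m n i)) (trans (cong (splitAt m) eq) (splitAt-↑ˡ m j n))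
... | ()

∈-tabulate⇔ : ∀ {n} {f : Fin n → Bool} {i} → i ∈ tabulate f ⇔ f i ≡ true
∈-tabulate⇔ {f = f} {i} = mk⇔
  (λ i∈ → trans (sym (lookup∘tabulate f i)) ([]=⇒lookup i∈))
  (λ fi → lookup⇒[]= i _ (trans (lookup∘tabulate f i) fi))

∈-tabulate-lookup⇔ : ∀ {m n} {I : Subset m} {f : Fin n → Fin m} {i} → i ∈ tabulate (lookup I ∘ f) ⇔ f i ∈ I
∈-tabulate-lookup⇔ {I = I} = mk⇔ (λ i∈ → lookup⇒[]= _ I (Equivalence.to ∈-tabulate⇔ i∈))
                                  (λ i∈ → Equivalence.from ∈-tabulate⇔ ([]=⇒lookup i∈))

module _ {n : ℕ} (S Q : Subset n) {D D′ : Subset n} where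

  S∩∁Q∩D⊆S∩D′ : (∀ {j} → j ∉ Q → j ∈ D → j ∈ D′) → (S ∩ ∁ Q) ∩ D ⊆ S ∩ D′
  S∩∁Q∩D⊆S∩D′ D⊆D′ j∈ =
    let j∈S∩∁Q , j∈D = x∈p∩q⁻ _ _ j∈
        j∈S , j∈∁Q   = x∈p∩q⁻ S (∁ Q) j∈S∩∁Q
    in x∈p∩q⁺ (j∈S , D⊆D′ (x∈∁p⇒x∉p j∈∁Q) j∈D)

  S∩D′⊆S∩∁Q∩D∪S∩Q : (∀ {j} → j ∉ Q → j ∈ D′ → j ∈ D) → S ∩ D′ ⊆ ((S ∩ ∁ Q) ∩ D) ∪ (S ∩ Q)
  S∩D′⊆S∩∁Q∩D∪S∩Q D′⊆D {j} j∈ with x∈p∩q⁻ S D′ j∈ | j ∈? Q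
  ... | j∈S , _    | yes j∈Q = x∈p∪q⁺ (inj₂ (x∈p∩q⁺ (j∈S , j∈Q)))
  ... | j∈S , j∈D′ | no  j∉Q = x∈p∪q⁺ (inj₁ (x∈p∩q⁺ (x∈p∩q⁺ (j∈S , x∉p⇒x∈∁p j∉Q) , D′⊆D j∉Q j∈D′)))

  S∩D′⊆S∩∁Q∩D : (∀ {j} → j ∉ Q → j ∈ D′ → j ∈ D) → (∀ {j} → j ∈ Q → j ∉ D′) → S ∩ D′ ⊆ (S ∩ ∁ Q) ∩ D
  S∩D′⊆S∩∁Q∩D D′⊆D Q∩D′≡∅ j∈ with x∈p∪q⁻ _ _ (S∩D′⊆S∩∁Q∩D∪S∩Q D′⊆D j∈)
  ... | inj₁ j∈A   = j∈A
  ... | inj₂ j∈S∩Q = contradiction (proj₂ (x∈p∩q⁻ S D′ j∈)) (Q∩D′≡∅ (proj₂ (x∈p∩q⁻ S Q j∈S∩Q)))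

  S∩∁Q∩D∪S∩Q⊆S∩D′ : (∀ {j} → j ∉ Q → j ∈ D → j ∈ D′) → Q ⊆ D′ → ((S ∩ ∁ Q) ∩ D) ∪ (S ∩ Q) ⊆ S ∩ D′
  S∩∁Q∩D∪S∩Q⊆S∩D′ D⊆D′ Q⊆D′ j∈ with x∈p∪q⁻ _ _ j∈
  ... | inj₁ j∈A   = S∩∁Q∩D⊆S∩D′ D⊆D′ j∈A
  ... | inj₂ j∈S∩Q = let j∈S , j∈Q = x∈p∩q⁻ S Q j∈S∩Q in x∈p∩q⁺ (j∈S , Q⊆D′ j∈Q)

module Subspaces (L : ℕ) where

  state : (Fin L → Bool) → (Fin L → Bool) → State L
  state n d p = [ n , d ]′ (splitAt L p)

  nPart-state : ∀ n d i → nPart L (state n d) i ≡ n i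
  nPart-state n d i rewrite splitAt-↑ˡ L i L = refl

  dPart-state : ∀ n d i → dPart L (state n d) i ≡ d i
  dPart-state n d i rewrite splitAt-↑ʳ L L i = refl

  ∈IN⇔ : ∀ {I i} → i ∈ IN L I ⇔ (i ↑ˡ L) ∈ I
  ∈IN⇔ = ∈-tabulate-lookup⇔

  ∈ID⇔ : ∀ {I i} → i ∈ ID L I ⇔ (L ↑ʳ i) ∈ I
  ∈ID⇔ = ∈-tabulate-lookup⇔

  Dset-agreeOff : ∀ {x z I j} → Subspace L x I z → j ∉ ID L I → j ∈ Dset L x → j ∈ Dset L z
  Dset-agreeOff {x} {z} z∈ j∉ j∈ =
    Equivalence.from ∈-tabulate⇔ (trans (z∈ _ (j∉ ∘ Equivalence.from ∈ID⇔)) (Equivalence.to ∈-tabulate⇔ j∈))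

  Subspace-refl : ∀ x I → Subspace L x I x
  Subspace-refl x I p p∉ = refl

  Subspace-sym : ∀ {x z I} → Subspace L x I z → Subspace L z I x
  Subspace-sym z∈ p p∉ = sym (z∈ p p∉)

  subspace-recentre : ∀ {x z I} → Subspace L x I z → SameSet L (Subspace L x I) (Subspace L z I)
  subspace-recentre z∈ y = (λ y∈ p p∉ → trans (y∈ p p∉) (sym (z∈ p p∉)))
                         , (λ y∈ p p∉ → trans (y∈ p p∉) (z∈ p p∉))

  SameSet-sym : {A B : State L → Set} → SameSet L A B → SameSet L B A
  SameSet-sym A≈B y = proj₂ (A≈B y) , proj₁ (A≈B y)

  flip-here : ∀ y p → flip L y p p ≡ not (y p)
  flip-here y p with p ≟ p
  ... | yes _   = refl
  ... | no  p≢p = contradiction refl p≢p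

  flip-elsewhere : ∀ y p q → q ≢ p → flip L y p q ≡ y q
  flip-elsewhere y p q q≢p with q ≟ p
  ... | yes q≡p = contradiction q≡p q≢p
  ... | no  _   = refl

  clamp : Bool → State L → Subset (L + L) → State L
  clamp b x I = state (nPart L x) (λ j → if does ((L ↑ʳ j) ∈? I) then b else dPart L x j)

  clamp∈ : ∀ b x I → Subspace L x I (clamp b x I)
  clamp∈ b x I = ↑ˡ-↑ʳ-elim _ (λ i _ → nPart-state _ _ i) λ j j∉ →
    trans (dPart-state _ _ j) (cong (λ c → if c then b else dPart L x j) (dec-false ((L ↑ʳ j) ∈? I) j∉))

  dPart-clamp : ∀ b x I {j} → (L ↑ʳ j) ∈ I → dPart L (clamp b x I) j ≡ b
  dPart-clamp b x I {j} j∈ =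
    trans (dPart-state _ _ j) (cong (λ c → if c then b else dPart L x j) (dec-true ((L ↑ʳ j) ∈? I) j∈))

module Dynamics {L : ℕ} (G : Graph L) (k : ℕ) where

  open Subspaces L

  F-↑ˡ : ∀ x i → F L G k x (i ↑ˡ L) ≡ (k ≤ᵇ neighSum L G x i)
  F-↑ˡ x i rewrite splitAt-↑ˡ L i L = refl

  F-↑ʳ : ∀ x i → F L G k x (L ↑ʳ i) ≡ not (nPart L x i)
  F-↑ʳ x i rewrite splitAt-↑ʳ L L i = refl

  FrozenSteady : State L → Subset (L + L) → Set
  FrozenSteady x I = ∀ z → Subspace L x I z → ∀ p → p ∉ I → F L G k z p ≡ z p

  trapSet⇔frozenSteady : ∀ {x I} → IsTrapSet L G k (Subspace L x I) ⇔ FrozenSteady x I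
  trapSet⇔frozenSteady {x} {I} = mk⇔ steady trap
    where
    steady : IsTrapSet L G k (Subspace L x I) → FrozenSteady x I
    steady isTrap z z∈ p p∉ with F L G k z p ≟ᵇ z p
    ... | yes Fz≡z = Fz≡z
    ... | no  Fz≢z = contradiction (trans (sym (flip-here z p)) (trans (isTrap z z∈ p Fz≢z p p∉) (sym (z∈ p p∉))))
                                   (not-¬ refl ∘ sym)
    trap : FrozenSteady x I → IsTrapSet L G k (Subspace L x I)
    trap frozen z z∈ p Fz≢z q q∉ with q ≟ p
    ... | yes refl = contradiction (frozen z z∈ q q∉) Fz≢z
    ... | no  _    = z∈ q q∉

  trapSet-resp-SameSet : {A B : State L → Set} → SameSet L A B → IsTrapSet L G k A → IsTrapSet L G k B
  trapSet-resp-SameSet A≈B isTrap y y∈B p Fy≢y =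
    proj₁ (A≈B (flip L y p)) (isTrap y (proj₂ (A≈B y) y∈B) p Fy≢y)

  neighSum-lower : ∀ {x z I} → Subspace L x I z → ∀ i →
                   ∣ (S G i ∩ ∁ (ID L I)) ∩ Dset L x ∣ ≤ neighSum L G z i
  neighSum-lower {I = I} z∈ i = p⊆q⇒∣p∣≤∣q∣ (S∩∁Q∩D⊆S∩D′ (S G i) (ID L I) (Dset-agreeOff z∈))

  neighSum-upper : ∀ {x z I} → Subspace L x I z → ∀ i →
                   neighSum L G z i ≤ ∣ ((S G i ∩ ∁ (ID L I)) ∩ Dset L x) ∪ (S G i ∩ ID L I) ∣
  neighSum-upper {I = I} z∈ i = p⊆q⇒∣p∣≤∣q∣ (S∩D′⊆S∩∁Q∩D∪S∩Q (S G i) (ID L I) (Dset-agreeOff (Subspace-sym z∈)))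

  conditions⇒frozenSteady : ∀ {x I} → FixedPoint L G k x → IN L I ⊆ ID L I → Conditions L G k x I →
                            FrozenSteady x I
  conditions⇒frozenSteady {x} {I} fixed IN⊆ID conditions z z∈ = ↑ˡ-↑ʳ-elim _ steady-n steady-d
    where
    steady-n : ∀ i → (i ↑ˡ L) ∉ I → F L G k z (i ↑ˡ L) ≡ z (i ↑ˡ L)
    steady-n i i∉ = trans (F-↑ˡ z i) (trans (threshold (nPart L x i) refl) (sym (z∈ _ i∉)))
      where
      i∉IN : i ∉ IN L I
      i∉IN = i∉ ∘ Equivalence.to ∈IN⇔
      threshold : ∀ b → nPart L x i ≡ b → (k ≤ᵇ neighSum L G z i) ≡ b
      threshold true  xᵢ = ≤⇒≤ᵇ≡true (≤-trans (proj₁ (conditions i i∉IN) xᵢ) (neighSum-lower z∈ i))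
      threshold false xᵢ = >⇒≤ᵇ≡false (≤-<-trans (neighSum-upper z∈ i) (proj₂ (conditions i i∉IN) xᵢ))
    steady-d : ∀ i → (L ↑ʳ i) ∉ I → F L G k z (L ↑ʳ i) ≡ z (L ↑ʳ i)
    steady-d i i∉ = begin
      F L G k z (L ↑ʳ i)  ≡⟨ F-↑ʳ z i ⟩
      not (z (i ↑ˡ L))    ≡⟨ cong not (z∈ _ n∉) ⟩
      not (x (i ↑ˡ L))    ≡⟨ sym (F-↑ʳ x i) ⟩
      F L G k x (L ↑ʳ i)  ≡⟨ fixed (L ↑ʳ i) ⟩
      x (L ↑ʳ i)          ≡⟨ sym (z∈ _ i∉) ⟩
      z (L ↑ʳ i)          ∎
      where
      open ≡-Reasoning
      n∉ : (i ↑ˡ L) ∉ I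
      n∉ = i∉ ∘ Equivalence.to ∈ID⇔ ∘ IN⊆ID ∘ Equivalence.from ∈IN⇔

  frozenSteady⇒IN⊆ID : ∀ {y J} → FrozenSteady y J → IN L J ⊆ ID L J
  frozenSteady⇒IN⊆ID {y} {J} frozen {i} i∈IN with (L ↑ʳ i) ∈? J
  ... | yes d∈ = Equivalence.from ∈ID⇔ d∈
  ... | no  d∉ = contradiction (begin
    not (not (y (i ↑ˡ L)))  ≡⟨ cong not (sym (flip-here y (i ↑ˡ L))) ⟩
    not (z (i ↑ˡ L))        ≡⟨ sym (F-↑ʳ z i) ⟩
    F L G k z (L ↑ʳ i)      ≡⟨ frozen z z∈ _ d∉ ⟩
    z (L ↑ʳ i)              ≡⟨ flip-elsewhere y _ _ (↑ʳ≢↑ˡ i i) ⟩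
    y (L ↑ʳ i)              ≡⟨ sym (frozen y (Subspace-refl y J) _ d∉) ⟩
    F L G k y (L ↑ʳ i)      ≡⟨ F-↑ʳ y i ⟩
    not (y (i ↑ˡ L))        ∎) (not-¬ refl ∘ sym)
    where
    open ≡-Reasoning
    z : State L
    z = flip L y (i ↑ˡ L)
    z∈ : Subspace L y J z
    z∈ p p∉ = flip-elsewhere y _ p (λ { refl → p∉ (Equivalence.to ∈IN⇔ i∈IN) })

  frozenSteady⇒fixedPoint : .{{_ : NonZero k}} → ∀ {y J} → FrozenSteady y J → IN L J ⊆ ID L J →
                            Σ (State L) λ x → FixedPoint L G k x × Subspace L y J x
  frozenSteady⇒fixedPoint {y} {J} frozen IN⊆ID
    with ThresholdNetwork.settle (adj G) (symmetric G) (loopless G) k (λ i → (i ↑ˡ L) ∈? J) (not ∘ nPart L y)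
  ... | d , stable , agrees = x , fixed , x∈
    where
    open ThresholdNetwork (adj G) (symmetric G) (loopless G) k using (count)
    x : State L
    x = state (not ∘ d) d
    neighSum≡count : ∀ i → neighSum L G x i ≡ count d i
    neighSum≡count i = trans (∣tabulate∩tabulate∣≡∑ (adj G i) (dPart L x))
                             (sum-cong-≗ (λ j → cong (λ b → iverson (adj G i j ∧ b)) (dPart-state _ d j)))
    x∈ : Subspace L y J x
    x∈ = ↑ˡ-↑ʳ-elim _ n-agrees d-agrees
      where
      n-agrees : ∀ i → (i ↑ˡ L) ∉ J → x (i ↑ˡ L) ≡ y (i ↑ˡ L)
      n-agrees i n∉ = trans (nPart-state _ d i) (trans (cong not (agrees i n∉)) (not-involutive _))
      d-agrees : ∀ i → (L ↑ʳ i) ∉ J → x (L ↑ʳ i) ≡ y (L ↑ʳ i)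
      d-agrees i d∉ = begin
        x (L ↑ʳ i)          ≡⟨ dPart-state _ d i ⟩
        d i                 ≡⟨ agrees i (d∉ ∘ Equivalence.to ∈ID⇔ ∘ IN⊆ID ∘ Equivalence.from ∈IN⇔) ⟩
        not (y (i ↑ˡ L))    ≡⟨ sym (F-↑ʳ y i) ⟩
        F L G k y (L ↑ʳ i)  ≡⟨ frozen y (Subspace-refl y J) _ d∉ ⟩
        y (L ↑ʳ i)          ∎
        where open ≡-Reasoning
    fixed : FixedPoint L G k x
    fixed = ↑ˡ-↑ʳ-elim _ fixed-n fixed-d
      where
      fixed-n : ∀ i → F L G k x (i ↑ˡ L) ≡ x (i ↑ˡ L)
      fixed-n i with (i ↑ˡ L) ∈? J
      ... | no  n∉   = frozen x x∈ _ n∉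
      ... | yes free = begin
        F L G k x (i ↑ˡ L)   ≡⟨ F-↑ˡ x i ⟩
        k ≤ᵇ neighSum L G x i ≡⟨ cong (k ≤ᵇ_) (neighSum≡count i) ⟩
        k ≤ᵇ count d i       ≡⟨ sym (not-involutive _) ⟩
        not (not (k ≤ᵇ count d i)) ≡⟨ cong not (sym (stable i free)) ⟩
        not (d i)            ≡⟨ sym (nPart-state _ d i) ⟩
        x (i ↑ˡ L)           ∎
        where open ≡-Reasoning
      fixed-d : ∀ i → F L G k x (L ↑ʳ i) ≡ x (L ↑ʳ i)
      fixed-d i = trans (F-↑ʳ x i) (trans (cong not (nPart-state _ d i))
                    (trans (not-involutive (d i)) (sym (dPart-state _ d i))))

  frozenSteady⇒conditions : ∀ {x I} → FrozenSteady x I → Conditions L G k x I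
  frozenSteady⇒conditions {x} {I} frozen i i∉IN = lower , upper
    where
    n∉ : (i ↑ˡ L) ∉ I
    n∉ = i∉IN ∘ Equivalence.from ∈IN⇔
    threshold : ∀ {z} → Subspace L x I z → (k ≤ᵇ neighSum L G z i) ≡ nPart L x i
    threshold z∈ = trans (sym (F-↑ˡ _ i)) (trans (frozen _ z∈ _ n∉) (z∈ _ n∉))
    cleared : ∀ {j} → j ∈ ID L I → j ∉ Dset L (clamp false x I)
    cleared j∈ j∈D = contradiction (trans (sym (dPart-clamp false x I (Equivalence.to ∈ID⇔ j∈)))
                                          (Equivalence.to ∈-tabulate⇔ j∈D)) λ ()
    filled : ID L I ⊆ Dset L (clamp true x I)
    filled j∈ = Equivalence.from ∈-tabulate⇔ (dPart-clamp true x I (Equivalence.to ∈ID⇔ j∈))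
    lower : nPart L x i ≡ true → k ≤ ∣ (S G i ∩ ∁ (ID L I)) ∩ Dset L x ∣
    lower xᵢ = ≤-trans (≤ᵇ≡true⇒≤ (trans (threshold (clamp∈ false x I)) xᵢ))
      (p⊆q⇒∣p∣≤∣q∣ (S∩D′⊆S∩∁Q∩D (S G i) (ID L I) (Dset-agreeOff (Subspace-sym (clamp∈ false x I))) cleared))
    upper : nPart L x i ≡ false → ∣ ((S G i ∩ ∁ (ID L I)) ∩ Dset L x) ∪ (S G i ∩ ID L I) ∣ < k
    upper xᵢ = ≤-<-trans
      (p⊆q⇒∣p∣≤∣q∣ (S∩∁Q∩D∪S∩Q⊆S∩D′ (S G i) (ID L I) (Dset-agreeOff (clamp∈ true x I)) filled))
      (≤ᵇ≡false⇒> (trans (threshold (clamp∈ true x I)) xᵢ))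

  FixedPointSubspace : State L → Subset (L + L) → Set
  FixedPointSubspace y J = Σ (State L) λ x → Σ (Subset (L + L)) λ I →
    FixedPoint L G k x × IN L I ⊆ ID L I × Conditions L G k x I
    × SameSet L (Subspace L y J) (Subspace L x I)

  trapSet⇒fixedPointSubspace : .{{_ : NonZero k}} → ∀ {y J} →
                               IsTrapSet L G k (Subspace L y J) → FixedPointSubspace y J
  trapSet⇒fixedPointSubspace {y} {J} isTrap =
    x , J , fixed , IN⊆ID , frozenSteady⇒conditions frozenₓ , y[J]≈x[J]
    where
    frozen : FrozenSteady y J
    frozen = Equivalence.to trapSet⇔frozenSteady isTrap
    IN⊆ID : IN L J ⊆ ID L J
    IN⊆ID = frozenSteady⇒IN⊆ID frozen
    fixedPointInside : Σ (State L) λ x → FixedPoint L G k x × Subspace L y J x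
    fixedPointInside = frozenSteady⇒fixedPoint frozen IN⊆ID
    x : State L
    x = proj₁ fixedPointInside
    fixed : FixedPoint L G k x
    fixed = proj₁ (proj₂ fixedPointInside)
    y[J]≈x[J] : SameSet L (Subspace L y J) (Subspace L x J)
    y[J]≈x[J] = subspace-recentre (proj₂ (proj₂ fixedPointInside))
    frozenₓ : FrozenSteady x J
    frozenₓ = Equivalence.to trapSet⇔frozenSteady (trapSet-resp-SameSet y[J]≈x[J] isTrap)

  fixedPointSubspace⇒trapSet : ∀ {y J} → FixedPointSubspace y J → IsTrapSet L G k (Subspace L y J)
  fixedPointSubspace⇒trapSet (x , I , fixed , IN⊆ID , conditions , y[J]≈x[I]) =
    trapSet-resp-SameSet (SameSet-sym y[J]≈x[I])
      (Equivalence.from trapSet⇔frozenSteady (conditions⇒frozenSteady fixed IN⊆ID conditions))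

proposition12 : (L : ℕ) (G : Graph L) (k : ℕ) → 1 ≤ k →
    (y : State L) (J : Subset (L + L)) →
    IsTrapSet L G k (Subspace L y J) ⇔
      Σ (State L) (λ x → Σ (Subset (L + L)) (λ I →
        FixedPoint L G k x × IN L I ⊆ ID L I × Conditions L G k x I
        × SameSet L (Subspace L y J) (Subspace L x I)))
proposition12 L G k k≥1 y J =
  mk⇔ (trapSet⇒fixedPointSubspace {{>-nonZero k≥1}}) fixedPointSubspace⇒trapSet
  where open Dynamics G k
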